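{- Let $\mathcal B'\subseteq\mathcal B\subseteq\mathcal P([n])$ be simply rooted families, and let $B\in\mathcal B'$ with $d_{\mathcal B'}(B)=B$. Then $d_{\mathcal B}(B)=B$.
   Context: A family $\mathcal F$ is simply rooted if for every nonempty $F\in\mathcal F$ there is $b\in F$ with $\{C:\{b\}\subseteq C\subseteq F\}\subseteq\mathcal F$. For $\mathcal F\subseteq\mathcal P([n])$ and $i\in[n]$: $d_{(i,\mathcal F)}(F)=F\setminus\{i\}$ if $i\in F$ and $F\setminus\{i\}\notin\mathcal F$, else $F$; $d_i(\mathcal F)=\{d_{(i,\mathcal F)}(F):F\in\mathcal F\}$. For a family $\mathcal F$ with $\mathcal F_0=\mathcal F$, $\mathcal F_k=d_k(\mathcal F_{k-1})$, define for $F\in\mathcal F$: $d_{\mathcal F}(F)=d_{(n,\mathcal F_{n-1})}\circ\cdots\circ d_{(1,\mathcal F_0)}(F)$. -}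

module Defs where

open import Data.Nat using (ℕ)
open import Data.Bool using (Bool; true; false; if_then_else_; _∧_; not)
import Data.Bool.Properties as BP
open import Data.Fin using (Fin)
open import Data.Fin.Subset using (Subset; ⁅_⁆; _─_; _⊆_; Nonempty)
  renaming (_∈_ to _∈ˢ_)
open import Data.Fin.Subset.Properties using (_∈?_)
open import Data.List using (List; []; _∷_; map; allFin)
open import Data.Vec.Properties using (≡-dec)
open import Data.Product using (∃; _×_)
open import Relation.Nullary.Decidable using (does)
open import Relation.Binary.PropositionalEquality using (_≡_)
import Data.List.Membership.DecPropositional as DecMem

-- A family of subsets of [n] = Fin n, given as a finite list of subsets
-- (duplicates are irrelevant: only membership matters).
Family : ℕ → Set
Family n = List (Subset n)

module _ {n : ℕ} where
  private module M = DecMem (≡-dec {n = n} BP._≟_)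

  _∈ᶠ_ : Subset n → Family n → Set
  F ∈ᶠ ℱ = F M.∈ ℱ

  _∈ᶠ?_ : (F : Subset n) (ℱ : Family n) → Relation.Nullary.Decidable.Dec (F ∈ᶠ ℱ)
  F ∈ᶠ? ℱ = F M.∈? ℱ

  _⊆ᶠ_ : Family n → Family n → Set
  ℱ ⊆ᶠ 𝒢 = ∀ F → F ∈ᶠ ℱ → F ∈ᶠ 𝒢

  SimplyRooted : Family n → Set
  SimplyRooted ℱ = ∀ F → F ∈ᶠ ℱ → Nonempty F →
    ∃ λ b → b ∈ˢ F × (∀ C → ⁅ b ⁆ ⊆ C → C ⊆ F → C ∈ᶠ ℱ)

  dStep : Family n → Fin n → Subset n → Subset n
  dStep ℱ i F =
    if does (i ∈? F) ∧ not (does ((F ─ ⁅ i ⁆) ∈ᶠ? ℱ)) then F ─ ⁅ i ⁆ else F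

  dFam : Fin n → Family n → Family n
  dFam i ℱ = map (dStep ℱ i) ℱ

  dSeq : List (Fin n) → Family n → Subset n → Subset n
  dSeq []       ℱ F = F
  dSeq (i ∷ is) ℱ F = dSeq is (dFam i ℱ) (dStep ℱ i F)

  -- d_ℱ(F) = d_(n,ℱ_{n-1}) ∘ ⋯ ∘ d_(1,ℱ_0)(F); indices 1..n are Fin n in order 0..n-1
  dDown : Family n → Subset n → Subset n
  dDown ℱ F = dSeq (allFin n) ℱ F

module Submission where

-- Lemma 15 is an instance of a more general monotonicity fact: for ANY
-- families ℬ′ ⊆ ℬ and any sequence of indices i₁, …, iₖ, if the iterated
-- down-shift along ℬ′ fixes a set B, then so does the one along ℬ.
--
-- Each shift d_(i,ℱ) only removes elements, so a composite of shifts that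
-- fixes B must fix B at every single step.  For one step we compare ℱ′ ⊆ ℱ:
-- either both families shift F in the same way, or ℱ′ moves F to F ∖ {i}
-- while ℱ keeps F because F ∖ {i} ∈ ℱ.  This gives (a) a step fixing B
-- along ℱ′ also fixes B along ℱ, since B ∖ {i} ≠ B when i ∈ B, and
-- (b) d_i(ℱ′) ⊆ d_i(ℱ), since in the second case F ∖ {i} is itself in ℱ and
-- is left alone by d_(i,ℱ).  Fact (b) lets the inclusion ℱ′ ⊆ ℱ be carried
-- through the sequence of updated families, and induction on the index
-- list concludes.

open import Defs
open import Data.Nat using (ℕ)
open import Data.Fin using (Fin)
open import Data.Fin.Subset using (Subset; ⁅_⁆; _─_; _⊆_; _∈_; _∉_; inside)
open import Data.Fin.Subset.Properties using (_∈?_; x∈⁅x⁆; p─q⊆p; ⊆-trans; ⊆-antisym)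
open import Data.Vec using (_∷_; here; there)
open import Data.List using (List; []; _∷_; allFin)
open import Data.List.Membership.Propositional.Properties using (∈-map⁺; ∈-map⁻)
open import Data.Product using (_,_; _×_)
open import Data.Sum using (_⊎_; inj₁; inj₂)
open import Function using (id)
open import Relation.Nullary using (¬_; Dec; yes; no; contradiction)
open import Relation.Nullary.Decidable using (dec-true; dec-false)
open import Relation.Binary.PropositionalEquality using (_≡_; refl; sym; trans; subst)

x∈q⇒x∉p─q : ∀ {n} (p q : Subset n) {x : Fin n} → x ∈ q → x ∉ p ─ q
x∈q⇒x∉p─q (_ ∷ p) (inside  ∷ q) here      ()
x∈q⇒x∉p─q (_ ∷ p) (_       ∷ q) (there x∈q) (there x∈p─q) = x∈q⇒x∉p─q p q x∈q x∈p─q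

module _ {n : ℕ} (ℱ : Family n) {i : Fin n} {F : Subset n} where

  dStep-absent : i ∉ F → dStep ℱ i F ≡ F
  dStep-absent i∉F rewrite dec-false (i ∈? F) i∉F = refl

  dStep-kept : i ∈ F → (F ─ ⁅ i ⁆) ∈ᶠ ℱ → dStep ℱ i F ≡ F
  dStep-kept i∈F F-i∈ℱ
    rewrite dec-true (i ∈? F) i∈F | dec-true ((F ─ ⁅ i ⁆) ∈ᶠ? ℱ) F-i∈ℱ = refl

  dStep-moved : i ∈ F → ¬ (F ─ ⁅ i ⁆) ∈ᶠ ℱ → dStep ℱ i F ≡ F ─ ⁅ i ⁆
  dStep-moved i∈F F-i∉ℱ
    rewrite dec-true (i ∈? F) i∈F | dec-false ((F ─ ⁅ i ⁆) ∈ᶠ? ℱ) F-i∉ℱ = refl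

dStep-⊆ : ∀ {n} (ℱ : Family n) (i : Fin n) (F : Subset n) → dStep ℱ i F ⊆ F
dStep-⊆ ℱ i F = by-cases (i ∈? F) ((F ─ ⁅ i ⁆) ∈ᶠ? ℱ)
  where
  by-cases : Dec (i ∈ F) → Dec ((F ─ ⁅ i ⁆) ∈ᶠ ℱ) → dStep ℱ i F ⊆ F
  by-cases (no i∉F)  _ = subst (_⊆ F) (sym (dStep-absent ℱ i∉F)) id
  by-cases (yes i∈F) (yes F-i∈ℱ) = subst (_⊆ F) (sym (dStep-kept ℱ i∈F F-i∈ℱ)) id
  by-cases (yes i∈F) (no F-i∉ℱ) =
    subst (_⊆ F) (sym (dStep-moved ℱ i∈F F-i∉ℱ)) (p─q⊆p F ⁅ i ⁆)

dSeq-⊆ : ∀ {n} (is : List (Fin n)) (ℱ : Family n) (F : Subset n) → dSeq is ℱ F ⊆ F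
dSeq-⊆ []       ℱ F = id
dSeq-⊆ (i ∷ is) ℱ F = ⊆-trans (dSeq-⊆ is (dFam i ℱ) (dStep ℱ i F)) (dStep-⊆ ℱ i F)

-- If an iterated shift fixes F, its first step already fixes F:
-- F = dSeq … (dStep ℱ i F) ⊆ dStep ℱ i F ⊆ F.
dSeq-fixed⇒dStep-fixed : ∀ {n} (is : List (Fin n)) (ℱ : Family n) (i : Fin n)
  (F : Subset n) → dSeq (i ∷ is) ℱ F ≡ F → dStep ℱ i F ≡ F
dSeq-fixed⇒dStep-fixed is ℱ i F fixed =
  ⊆-antisym (dStep-⊆ ℱ i F)
            (subst (_⊆ dStep ℱ i F) fixed (dSeq-⊆ is (dFam i ℱ) (dStep ℱ i F)))

dStep-compare : ∀ {n} {ℱ′ ℱ : Family n} → ℱ′ ⊆ᶠ ℱ → (i : Fin n) (F : Subset n) →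
  dStep ℱ′ i F ≡ dStep ℱ i F
  ⊎ (i ∈ F × (F ─ ⁅ i ⁆) ∈ᶠ ℱ × dStep ℱ′ i F ≡ F ─ ⁅ i ⁆)
dStep-compare {ℱ′ = ℱ′} {ℱ} ℱ′⊆ℱ i F =
  by-cases (i ∈? F) ((F ─ ⁅ i ⁆) ∈ᶠ? ℱ′) ((F ─ ⁅ i ⁆) ∈ᶠ? ℱ)
  where
  by-cases : Dec (i ∈ F) → Dec ((F ─ ⁅ i ⁆) ∈ᶠ ℱ′) → Dec ((F ─ ⁅ i ⁆) ∈ᶠ ℱ) →
    dStep ℱ′ i F ≡ dStep ℱ i F
    ⊎ (i ∈ F × (F ─ ⁅ i ⁆) ∈ᶠ ℱ × dStep ℱ′ i F ≡ F ─ ⁅ i ⁆)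
  by-cases (no i∉F) _ _ =
    inj₁ (trans (dStep-absent ℱ′ i∉F) (sym (dStep-absent ℱ i∉F)))
  by-cases (yes i∈F) (yes F-i∈ℱ′) _ =
    inj₁ (trans (dStep-kept ℱ′ i∈F F-i∈ℱ′) (sym (dStep-kept ℱ i∈F (ℱ′⊆ℱ _ F-i∈ℱ′))))
  by-cases (yes i∈F) (no F-i∉ℱ′) (no F-i∉ℱ) =
    inj₁ (trans (dStep-moved ℱ′ i∈F F-i∉ℱ′) (sym (dStep-moved ℱ i∈F F-i∉ℱ)))
  by-cases (yes i∈F) (no F-i∉ℱ′) (yes F-i∈ℱ) =
    inj₂ (i∈F , F-i∈ℱ , dStep-moved ℱ′ i∈F F-i∉ℱ′)

dStep-fixed-mono : ∀ {n} {ℱ′ ℱ : Family n} → ℱ′ ⊆ᶠ ℱ → (i : Fin n) (B : Subset n) →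
  dStep ℱ′ i B ≡ B → dStep ℱ i B ≡ B
dStep-fixed-mono ℱ′⊆ℱ i B fixed′ with dStep-compare ℱ′⊆ℱ i B
... | inj₁ same = trans (sym same) fixed′
... | inj₂ (i∈B , _ , moved) =
      contradiction (subst (i ∈_) (trans (sym fixed′) moved) i∈B)
                    (x∈q⇒x∉p─q B ⁅ i ⁆ (x∈⁅x⁆ i))

dFam-mono : ∀ {n} (i : Fin n) {ℱ′ ℱ : Family n} → ℱ′ ⊆ᶠ ℱ → dFam i ℱ′ ⊆ᶠ dFam i ℱ
dFam-mono i {ℱ′} {ℱ} ℱ′⊆ℱ _ G∈ with ∈-map⁻ (dStep ℱ′ i) G∈
... | F , F∈ℱ′ , refl with dStep-compare ℱ′⊆ℱ i F
...   | inj₁ same =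
        subst (_∈ᶠ dFam i ℱ) (sym same) (∈-map⁺ (dStep ℱ i) (ℱ′⊆ℱ F F∈ℱ′))
...   | inj₂ (_ , F-i∈ℱ , moved) =
        subst (_∈ᶠ dFam i ℱ) (trans F-i-fixed (sym moved)) (∈-map⁺ (dStep ℱ i) F-i∈ℱ)
  where
  F-i-fixed : dStep ℱ i (F ─ ⁅ i ⁆) ≡ F ─ ⁅ i ⁆
  F-i-fixed = dStep-absent ℱ (x∈q⇒x∉p─q F ⁅ i ⁆ (x∈⁅x⁆ i))

dSeq-fixed-mono : ∀ {n} (is : List (Fin n)) {ℱ′ ℱ : Family n} → ℱ′ ⊆ᶠ ℱ →
  (B : Subset n) → dSeq is ℱ′ B ≡ B → dSeq is ℱ B ≡ B
dSeq-fixed-mono []       ℱ′⊆ℱ B _ = refl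
dSeq-fixed-mono (i ∷ is) {ℱ′} {ℱ} ℱ′⊆ℱ B fixed =
  subst (λ G → dSeq is (dFam i ℱ) G ≡ B) (sym step-fixed)
    (dSeq-fixed-mono is (dFam-mono i ℱ′⊆ℱ) B
      (subst (λ G → dSeq is (dFam i ℱ′) G ≡ B) step-fixed′ fixed))
  where
  step-fixed′ : dStep ℱ′ i B ≡ B
  step-fixed′ = dSeq-fixed⇒dStep-fixed is ℱ′ i B fixed

  step-fixed : dStep ℱ i B ≡ B
  step-fixed = dStep-fixed-mono ℱ′⊆ℱ i B step-fixed′

lemma15 : (n : ℕ) (ℬ′ ℬ : Family n) → SimplyRooted ℬ′ → SimplyRooted ℬ →
    ℬ′ ⊆ᶠ ℬ → (B : Subset n) → B ∈ᶠ ℬ′ → dDown ℬ′ B ≡ B → dDown ℬ B ≡ B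
lemma15 n ℬ′ ℬ _ _ ℬ′⊆ℬ B _ = dSeq-fixed-mono (allFin n) ℬ′⊆ℬ B
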